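{- For every graph $G$ of order greater than $1$, we have $\textnormal{ftdim}(G) \le \dim(G)\,(2+3^{\dim(G)-1})$.
   Context: All graphs are finite, simple and undirected, and need not be connected; $\textnormal{dist}(u,v)=\infty$ if $u,v$ lie in different components. A set $S=\{v_1,\dots,v_k\}$ of vertices (with a fixed order) is a resolving set of $G$ if the vectors $d_S(u)=(\textnormal{dist}(u,v_1),\dots,\textnormal{dist}(u,v_k))$ are pairwise distinct over all $u\in V(G)$. The metric dimension $\dim(G)$ is the minimum size of a resolving set. The fault-tolerant metric dimension $\textnormal{ftdim}(G)$ is the minimum size of a nonempty set $S\subseteq V(G)$ such that $S-\{s\}$ is a resolving set of $G$ for every $s\in S$. -}

module Defs where

open import Data.Nat using (ℕ; zero; suc; _<_; _≤_)
open import Data.Fin using (Fin)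
open import Data.Fin.Subset using (Subset; _∈_; _─_; ⁅_⁆; ∣_∣; Nonempty)
open import Data.Maybe using (Maybe; just; nothing)
open import Data.Product using (_×_; ∃-syntax)
open import Relation.Nullary using (¬_)
open import Relation.Binary.PropositionalEquality using (_≡_; _≢_)

-- A finite simple undirected graph on the vertex set Fin n
-- (not necessarily connected).
record Graph (n : ℕ) : Set₁ where
  field
    Adj    : Fin n → Fin n → Set
    sym    : ∀ {u v} → Adj u v → Adj v u
    irrefl : ∀ {u} → ¬ Adj u u

open Graph public

data Walk {n : ℕ} (G : Graph n) : ℕ → Fin n → Fin n → Set where
  here : ∀ {u} → Walk G zero u u
  step : ∀ {k u w v} → Adj G u w → Walk G k w v → Walk G (suc k) u v

-- Extended naturals: nothing = ∞.
ℕ∞ : Set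
ℕ∞ = Maybe ℕ

Dist : ∀ {n} → Graph n → Fin n → Fin n → ℕ∞ → Set
Dist G u v (just k) = Walk G k u v × (∀ m → m < k → ¬ Walk G m u v)
Dist G u v nothing  = ∀ m → ¬ Walk G m u v

Resolving : ∀ {n} → Graph n → Subset n → Set
Resolving G S = ∀ u v → u ≢ v →
  ∃[ s ] (s ∈ S × ∃[ d₁ ] ∃[ d₂ ] (Dist G u s d₁ × Dist G v s d₂ × d₁ ≢ d₂))

IsMetricDim : ∀ {n} → Graph n → ℕ → Set
IsMetricDim G k =
  (∃[ S ] (Resolving G S × ∣ S ∣ ≡ k)) × (∀ S → Resolving G S → k ≤ ∣ S ∣)

FaultTolerantResolving : ∀ {n} → Graph n → Subset n → Set
FaultTolerantResolving G S = Nonempty S × (∀ s → s ∈ S → Resolving G (S ─ ⁅ s ⁆))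

IsFTMetricDim : ∀ {n} → Graph n → ℕ → Set
IsFTMetricDim G k =
  (∃[ S ] (FaultTolerantResolving G S × ∣ S ∣ ≡ k))
  × (∀ S → FaultTolerantResolving G S → k ≤ ∣ S ∣)

-- Let S be a metric basis and s ∈ S separate u from v, say d(u,s) < d(v,s).
-- Unless u = s, the neighbour w of s on a shortest u–s walk still separates
-- them, as d(u,w) = d(u,s) − 1 < d(v,w). If u = s, then v is separated
-- from s by S − s or by a neighbour of s, or else v is a non-neighbour of
-- s adjacent to all neighbours of s with the same distances to S − s as s.
-- Such a twin lies at distance 2 or ∞ from s, so by resolvability there is
-- at most one. Adding to S the neighbours and the twin of every s ∈ S thus
-- gives a fault-tolerant resolving set. A neighbour of s is within one of
-- d(s,t) from every t, and distinct neighbours are separated by S − s, so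
-- s has at most 3^(|S| − 1) neighbours.
--
-- Distances are only given as a relation and adjacency is not decidable, so
-- the distance function is obtained under a double negation, which is
-- harmless because the conclusion is a decidable inequality.
module Submission where

open import Defs hiding (sym)
open import Data.Nat using (ℕ; zero; suc; z≤n; s≤s; _<_; _≤_; _≤?_; _+_; _*_; _∸_; _^_)
open import Data.Nat.Induction using (<-rec)
open import Data.Nat.Properties
  using (≤-refl; ≤-trans; ≤-antisym; ≤-<-trans; ≮⇒≥; <-cmp; m≤n⇒m≤1+n;
         +-mono-≤; +-monoʳ-≤; n≤1+n; ≤-reflexive; +-suc; *-mono-≤; ^-monoʳ-≤; ∸-monoˡ-≤)
  renaming (_≟_ to _≟ℕ_)
open import Data.Fin using (Fin)
open import Data.Fin.Properties using (any?; all?) renaming (_≟_ to _≟ᶠ_)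
open import Data.Fin.Subset
  using (Subset; _∈_; _-_; _∪_; ⁅_⁆; ⋃; ∣_∣; Nonempty; inside; outside)
open import Data.Fin.Subset.Properties
  using (_∈?_; x∈p∪q⁺; x∈⁅x⁆; ∣⊥∣≡0; ∣⁅x⁆∣≡1; x∈p∧x≢y⇒x∈p-y; x∈p⇒∣p-x∣<∣p∣; p─q⊆p)
open import Data.Vec.Base using (here; there; []; _∷_)
open import Data.List.Base using (List; map; _++_; length; concatMap; cartesianProductWith)
  renaming ([] to []ˡ; _∷_ to _∷ˡ_; [_] to [_]ˡ)
open import Data.List.Properties using (length-++; length-map; ∷-injective)
  renaming (≡-dec to List-≡-dec)
import Data.List.Relation.Unary.Any as Any
open import Data.List.Membership.Propositional using () renaming (_∈_ to _∈ˡ_)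
open import Data.List.Membership.Propositional.Properties
  using (∈-map⁺; ∈-map⁻; ∈-++⁺ˡ; ∈-++⁺ʳ; ∈-concatMap⁺; ∈-cartesianProductWith⁺)
open import Data.Maybe using (just; nothing)
open import Data.Maybe.Properties using () renaming (≡-dec to Maybe-≡-dec)
open import Data.Product using (Σ; ∃; ∃-syntax; _×_; _,_; proj₁; proj₂)
open import Data.Sum using (_⊎_; inj₁; inj₂)
open import Data.Unit using (tt)
open import Data.Unit.Properties using () renaming (_≟_ to _≟⊤_)
open import Data.Empty using (⊥; ⊥-elim)
open import Function using (_∘_; const)
open import Relation.Nullary using (¬_; Dec; yes; no)
open import Relation.Nullary.Decidable
  using (_×-dec_; _→-dec_; ¬?; map′; decidable-stable; ¬¬-excluded-middle)
open import Relation.Nullary.Negation using (¬¬-map)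
open import Relation.Unary using (Pred; Decidable)
open import Relation.Binary.Definitions using (DecidableEquality; tri<; tri≈; tri>)
open import Relation.Binary.PropositionalEquality
  using (_≡_; _≢_; refl; sym; trans; cong; cong₂; subst; module ≡-Reasoning)

module _ {A B C : Set} where

  length-cartesianProductWith : (f : A → B → C) (xs : List A) (ys : List B) →
    length (cartesianProductWith f xs ys) ≡ length xs * length ys
  length-cartesianProductWith f []ˡ ys = refl
  length-cartesianProductWith f (x ∷ˡ xs) ys = begin
    length (map (f x) ys ++ cartesianProductWith f xs ys)
      ≡⟨ length-++ (map (f x) ys) ⟩
    length (map (f x) ys) + length (cartesianProductWith f xs ys)
      ≡⟨ cong₂ _+_ (length-map (f x) ys) (length-cartesianProductWith f xs ys) ⟩
    length ys + length xs * length ys ∎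
    where open ≡-Reasoning

module _ {A B : Set} where

  map-≡⇒∈-≡ : ∀ {f g : A → B} {xs x} → map f xs ≡ map g xs → x ∈ˡ xs → f x ≡ g x
  map-≡⇒∈-≡ {xs = _ ∷ˡ _} eq (Any.here refl) = proj₁ (∷-injective eq)
  map-≡⇒∈-≡ {xs = _ ∷ˡ _} eq (Any.there x∈xs) = map-≡⇒∈-≡ (proj₂ (∷-injective eq)) x∈xs

  length-concatMap-≤ : (f : A → List B) (k : ℕ) (xs : List A) →
    (∀ {x} → x ∈ˡ xs → length (f x) ≤ k) → length (concatMap f xs) ≤ length xs * k
  length-concatMap-≤ f k []ˡ _ = z≤n
  length-concatMap-≤ f k (x ∷ˡ xs) bound = begin
    length (f x ++ concatMap f xs)       ≡⟨ length-++ (f x) ⟩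
    length (f x) + length (concatMap f xs) ≤⟨ +-mono-≤ (bound (Any.here refl))
                                              (length-concatMap-≤ f k xs (bound ∘ Any.there)) ⟩
    k + length xs * k                    ∎
    where open Data.Nat.Properties.≤-Reasoning

choiceSequences : {A : Set} → List (List A) → List (List A)
choiceSequences []ˡ = [ []ˡ ]ˡ
choiceSequences (xs ∷ˡ xss) = cartesianProductWith _∷ˡ_ xs (choiceSequences xss)

module _ {A B : Set} (g : A → List B) where

  map-∈-choiceSequences : ∀ {f : A → B} → (∀ x → f x ∈ˡ g x) →
    ∀ xs → map f xs ∈ˡ choiceSequences (map g xs)
  map-∈-choiceSequences f∈g []ˡ = Any.here refl
  map-∈-choiceSequences f∈g (x ∷ˡ xs) =
    ∈-cartesianProductWith⁺ _∷ˡ_ (f∈g x) (map-∈-choiceSequences f∈g xs)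

  length-choiceSequences-≤ : ∀ {k} → (∀ x → length (g x) ≤ k) →
    ∀ xs → length (choiceSequences (map g xs)) ≤ k ^ length xs
  length-choiceSequences-≤ bound []ˡ = ≤-refl
  length-choiceSequences-≤ bound (x ∷ˡ xs) = begin
    length (choiceSequences (map g (x ∷ˡ xs)))
      ≡⟨ length-cartesianProductWith _∷ˡ_ (g x) (choiceSequences (map g xs)) ⟩
    length (g x) * length (choiceSequences (map g xs))
      ≤⟨ *-mono-≤ (bound x) (length-choiceSequences-≤ bound xs) ⟩
    _ ∎
    where open Data.Nat.Properties.≤-Reasoning

elements : ∀ {n} → Subset n → List (Fin n)
elements [] = []ˡ
elements (inside ∷ p) = Fin.zero ∷ˡ map Fin.suc (elements p)
elements (outside ∷ p) = map Fin.suc (elements p)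

length-elements : ∀ {n} (p : Subset n) → length (elements p) ≡ ∣ p ∣
length-elements [] = refl
length-elements (inside ∷ p) = cong suc (trans (length-map Fin.suc (elements p)) (length-elements p))
length-elements (outside ∷ p) = trans (length-map Fin.suc (elements p)) (length-elements p)

∈-elements⁺ : ∀ {n} {x : Fin n} {p} → x ∈ p → x ∈ˡ elements p
∈-elements⁺ {p = inside ∷ p} here = Any.here refl
∈-elements⁺ {p = inside ∷ p} (there x∈p) = Any.there (∈-map⁺ Fin.suc (∈-elements⁺ x∈p))
∈-elements⁺ {p = outside ∷ p} (there x∈p) = ∈-map⁺ Fin.suc (∈-elements⁺ x∈p)

∈-elements⁻ : ∀ {n} {x : Fin n} {p} → x ∈ˡ elements p → x ∈ p
∈-elements⁻ {p = inside ∷ p} (Any.here refl) = here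
∈-elements⁻ {p = inside ∷ p} (Any.there x∈) with ∈-map⁻ Fin.suc x∈
... | _ , y∈ , refl = there (∈-elements⁻ y∈)
∈-elements⁻ {p = outside ∷ p} x∈ with ∈-map⁻ Fin.suc x∈
... | _ , y∈ , refl = there (∈-elements⁻ y∈)

∣p∪q∣≤∣p∣+∣q∣ : ∀ {n} (p q : Subset n) → ∣ p ∪ q ∣ ≤ ∣ p ∣ + ∣ q ∣
∣p∪q∣≤∣p∣+∣q∣ [] [] = z≤n
∣p∪q∣≤∣p∣+∣q∣ (inside ∷ p) (inside ∷ q) =
  s≤s (≤-trans (∣p∪q∣≤∣p∣+∣q∣ p q) (+-monoʳ-≤ ∣ p ∣ (n≤1+n ∣ q ∣)))
∣p∪q∣≤∣p∣+∣q∣ (inside ∷ p) (outside ∷ q) = s≤s (∣p∪q∣≤∣p∣+∣q∣ p q)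
∣p∪q∣≤∣p∣+∣q∣ (outside ∷ p) (inside ∷ q) =
  subst (suc ∣ p ∪ q ∣ ≤_) (sym (+-suc ∣ p ∣ ∣ q ∣)) (s≤s (∣p∪q∣≤∣p∣+∣q∣ p q))
∣p∪q∣≤∣p∣+∣q∣ (outside ∷ p) (outside ∷ q) = ∣p∪q∣≤∣p∣+∣q∣ p q

fromList : ∀ {n} → List (Fin n) → Subset n
fromList xs = ⋃ (map ⁅_⁆ xs)

∈-fromList⁺ : ∀ {n} {x : Fin n} {xs} → x ∈ˡ xs → x ∈ fromList xs
∈-fromList⁺ (Any.here refl) = x∈p∪q⁺ (inj₁ (x∈⁅x⁆ _))
∈-fromList⁺ (Any.there x∈xs) = x∈p∪q⁺ (inj₂ (∈-fromList⁺ x∈xs))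

∣fromList∣≤length : ∀ {n} (xs : List (Fin n)) → ∣ fromList xs ∣ ≤ length xs
∣fromList∣≤length {n} []ˡ = ≤-reflexive (∣⊥∣≡0 n)
∣fromList∣≤length (x ∷ˡ xs) = ≤-trans (∣p∪q∣≤∣p∣+∣q∣ ⁅ x ⁆ (fromList xs))
  (subst (λ k → k + ∣ fromList xs ∣ ≤ suc (length xs)) (sym (∣⁅x⁆∣≡1 x)) (s≤s (∣fromList∣≤length xs)))

x∉p-x : ∀ {n} {x : Fin n} p → ¬ x ∈ p - x
x∉p-x {x = Fin.zero} (_ ∷ p) ()
x∉p-x {x = Fin.suc x} (_ ∷ p) (there x∈) = x∉p-x p x∈

x∈p-y⇒x≢y : ∀ {n} {x y : Fin n} {p} → x ∈ p - y → x ≢ y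
x∈p-y⇒x≢y {p = p} x∈ refl = x∉p-x p x∈

∣p-x∣≤∣p∣∸1 : ∀ {n} {x : Fin n} {p} → x ∈ p → ∣ p - x ∣ ≤ ∣ p ∣ ∸ 1
∣p-x∣≤∣p∣∸1 x∈p = ∸-monoˡ-≤ 1 (x∈p⇒∣p-x∣<∣p∣ x∈p)

-- Covering the elements of a decidable predicate on which f is injective

module _ {n} {B : Set} (_≟_ : DecidableEquality B)
         {p} {P : Pred (Fin n) p} (P? : Decidable P) (f : Fin n → B) where

  preimages : List B → List (Fin n)
  preimages []ˡ = []ˡ
  preimages (b ∷ˡ bs) with any? (λ x → P? x ×-dec f x ≟ b)
  ... | yes (x , _) = x ∷ˡ preimages bs
  ... | no _ = preimages bs

  length-preimages-≤ : ∀ bs → length (preimages bs) ≤ length bs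
  length-preimages-≤ []ˡ = z≤n
  length-preimages-≤ (b ∷ˡ bs) with any? (λ x → P? x ×-dec f x ≟ b)
  ... | yes _ = s≤s (length-preimages-≤ bs)
  ... | no _ = m≤n⇒m≤1+n (length-preimages-≤ bs)

  ∈-preimages : (∀ {x y} → P x → P y → f x ≡ f y → x ≡ y) →
    ∀ {x} bs → P x → f x ∈ˡ bs → x ∈ˡ preimages bs
  ∈-preimages inj (b ∷ˡ bs) Px fx∈ with any? (λ x → P? x ×-dec f x ≟ b) | fx∈
  ... | yes (y , Py , fy≡b) | Any.here fx≡b = Any.here (inj Px Py (trans fx≡b (sym fy≡b)))
  ... | yes _ | Any.there fx∈bs = Any.there (∈-preimages inj bs Px fx∈bs)
  ... | no ∄ | Any.here fx≡b = ⊥-elim (∄ (_ , Px , fx≡b))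
  ... | no _ | Any.there fx∈bs = ∈-preimages inj bs Px fx∈bs

-- Truncated subtraction makes the list have three entries even for m = 0.
around : ℕ∞ → List ℕ∞
around nothing = [ nothing ]ˡ
around (just m) = just (m ∸ 1) ∷ˡ just m ∷ˡ just (suc m) ∷ˡ []ˡ

length-around-≤ : ∀ e → length (around e) ≤ 3
length-around-≤ nothing = s≤s z≤n
length-around-≤ (just _) = ≤-refl

just∈around : ∀ {m b} → b ≤ suc m → m ≤ suc b → just b ∈ˡ around (just m)
just∈around {m} {b} b≤1+m m≤1+b with <-cmp b m
... | tri< b<m _ _ rewrite ≤-antisym m≤1+b b<m = Any.here refl
... | tri≈ _ refl _ = Any.there (Any.here refl)
... | tri> _ _ m<b rewrite ≤-antisym b≤1+m m<b = Any.there (Any.there (Any.here refl))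

module _ {n} {G : Graph n} where

  walk-zero : ∀ {u v} → Walk G 0 u v → u ≡ v
  walk-zero here = refl

  walk-one : ∀ {u v} → Walk G 1 u v → Adj G u v
  walk-one (step a here) = a

  snoc : ∀ {k u w v} → Walk G k u w → Adj G w v → Walk G (suc k) u v
  snoc here a = step a here
  snoc (step b p) a = step b (snoc p a)

  unsnoc : ∀ {k u v} → Walk G (suc k) u v → ∃[ w ] (Walk G k u w × Adj G w v)
  unsnoc (step a here) = _ , here , a
  unsnoc (step a (step b p)) with unsnoc (step b p)
  ... | w , q , c = w , step a q , c

  Dist-≤ : ∀ {u v k m} → Dist G u v (just k) → Walk G m u v → k ≤ m
  Dist-≤ (_ , minimal) w = ≮⇒≥ (λ m<k → minimal _ m<k w)

  Dist-functional : ∀ {u v a b} → Dist G u v a → Dist G u v b → a ≡ b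
  Dist-functional {a = nothing} {nothing} _ _ = refl
  Dist-functional {a = nothing} {just _} ∄ (w , _) = ⊥-elim (∄ _ w)
  Dist-functional {a = just _} {nothing} (w , _) ∄ = ⊥-elim (∄ _ w)
  Dist-functional {a = just _} {just _} da db =
    cong just (≤-antisym (Dist-≤ da (proj₁ db)) (Dist-≤ db (proj₁ da)))

  Dist-refl : ∀ {v} → Dist G v v (just 0)
  Dist-refl = here , λ _ ()

  Dist-adj : ∀ {u v} → Adj G u v → Dist G u v (just 1)
  Dist-adj a = step a here , λ where
    zero _ w → irrefl G (subst (Adj G _) (sym (walk-zero w)) a)
    (suc _) (s≤s ()) _

  Dist-two : ∀ {x w s} → x ≢ s → ¬ Adj G x s → Adj G x w → Adj G w s → Dist G x s (just 2)
  Dist-two x≢s ¬xs xw ws = step xw (step ws here) , λ where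
    zero _ p → x≢s (walk-zero p)
    (suc zero) _ p → ¬xs (walk-one p)
    (suc (suc _)) (s≤s (s≤s ())) _

  Dist-∞ : ∀ {x s} → x ≢ s → (∀ w → ¬ Adj G w s) → Dist G x s nothing
  Dist-∞ x≢s isolated zero p = x≢s (walk-zero p)
  Dist-∞ x≢s isolated (suc m) p = isolated _ (proj₂ (proj₂ (unsnoc p)))

  Dist-last-step : ∀ {u s k} → Dist G u s (just (suc k)) → ∃[ w ] (Adj G w s × Dist G u w (just k))
  Dist-last-step (p , minimal) with unsnoc p
  ... | w , q , a = w , a , q , λ m m<k r → minimal (suc m) (s≤s m<k) (snoc r a)

  Dist-neighbour : ∀ {w s t e e′} → Adj G w s → Dist G s t e → Dist G w t e′ → e′ ∈ˡ around e
  Dist-neighbour {e = nothing} {nothing} _ _ _ = Any.here refl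
  Dist-neighbour {e = nothing} {just _} a ∄ (p , _) = ⊥-elim (∄ _ (step (Graph.sym G a) p))
  Dist-neighbour {e = just _} {nothing} a (p , _) ∄ = ⊥-elim (∄ _ (step a p))
  Dist-neighbour {e = just _} {just _} a ds dw =
    just∈around (Dist-≤ dw (step a (proj₁ ds))) (Dist-≤ ds (step (Graph.sym G a) (proj₁ dw)))

-- Existence of distances, classically

¬¬-∀-Fin : ∀ {n} {P : Fin n → Set} → (∀ i → ¬ ¬ P i) → ¬ ¬ (∀ i → P i)
¬¬-∀-Fin {zero} _ ¬∀ = ¬∀ λ ()
¬¬-∀-Fin {suc n} {P} ¬¬P ¬∀ = ¬¬P Fin.zero λ P0 →
  ¬¬-∀-Fin {n} {P ∘ Fin.suc} (¬¬P ∘ Fin.suc) λ Psuc →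
    ¬∀ λ { Fin.zero → P0 ; (Fin.suc i) → Psuc i }

module _ {n} (G : Graph n) where

  ¬∃Dist⇒¬Walk : ∀ {u v} → ¬ ∃ (Dist G u v) → ∀ m → ¬ Walk G m u v
  ¬∃Dist⇒¬Walk {u} {v} ¬dist = <-rec (λ m → ¬ Walk G m u v) λ m shorter p →
    ¬¬-excluded-middle {A = ∃[ j ] (j < m × Walk G j u v)} λ where
      (yes (j , j<m , q)) → shorter j<m q
      (no ∄) → ¬dist (just m , p , λ j j<m q → ∄ (j , j<m , q))

  ¬¬-Dist : ∀ u v → ¬ ¬ ∃ (Dist G u v)
  ¬¬-Dist u v ¬dist = ¬dist (nothing , ¬∃Dist⇒¬Walk ¬dist)

  DistanceFunction : Set
  DistanceFunction = Σ (Fin n → Fin n → ℕ∞) λ D → ∀ u v → Dist G u v (D u v)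

  ¬¬-distance-function : ¬ ¬ DistanceFunction
  ¬¬-distance-function = ¬¬-map (λ dist → (λ u v → proj₁ (dist u v)) , λ u v → proj₂ (dist u v))
    (¬¬-∀-Fin λ u → ¬¬-∀-Fin λ v → ¬¬-Dist u v)

module Distances {n} (G : Graph n) (D : Fin n → Fin n → ℕ∞)
                 (D-dist : ∀ u v → Dist G u v (D u v)) where

  _≟∞_ : DecidableEquality ℕ∞
  _≟∞_ = Maybe-≡-dec _≟ℕ_

  D-≡ : ∀ {u v e} → Dist G u v e → D u v ≡ e
  D-≡ = Dist-functional (D-dist _ _)

  D-Dist : ∀ {u v e} → D u v ≡ e → Dist G u v e
  D-Dist {u} {v} eq = subst (Dist G u v) eq (D-dist u v)

  D≡0⇒≡ : ∀ {u v} → D u v ≡ just 0 → u ≡ v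
  D≡0⇒≡ = walk-zero ∘ proj₁ ∘ D-Dist

  adj⇒D≡1 : ∀ {u v} → Adj G u v → D u v ≡ just 1
  adj⇒D≡1 = D-≡ ∘ Dist-adj

  D≡1⇒adj : ∀ {u v} → D u v ≡ just 1 → Adj G u v
  D≡1⇒adj = walk-one ∘ proj₁ ∘ D-Dist

  adj? : ∀ u v → Dec (Adj G u v)
  adj? u v = map′ D≡1⇒adj adj⇒D≡1 (D u v ≟∞ just 1)

  adj⇒≢ : ∀ {u v} → Adj G u v → u ≢ v
  adj⇒≢ a refl = irrefl G a

  Closer : Fin n → Fin n → Fin n → Set
  Closer u v s = ∃[ k ] (D u s ≡ just k × ∀ m → m ≤ k → ¬ Walk G m v s)

  closer-or-closer : ∀ {u v s} → D u s ≢ D v s → Closer u v s ⊎ Closer v u s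
  closer-or-closer {u} {v} {s} ne with D u s | D-dist u s | D v s | D-dist v s
  ... | nothing | _ | nothing | _ = ⊥-elim (ne refl)
  ... | just i | _ | nothing | ∄ = inj₁ (i , refl , λ m _ → ∄ m)
  ... | nothing | ∄ | just j | _ = inj₂ (j , refl , λ m _ → ∄ m)
  ... | just i | (_ , du) | just j | (_ , dv) with <-cmp i j
  ...   | tri< i<j _ _ = inj₁ (i , refl , λ m m≤i → dv m (≤-<-trans m≤i i<j))
  ...   | tri≈ _ refl _ = ⊥-elim (ne refl)
  ...   | tri> _ _ j<i = inj₂ (j , refl , λ m m≤j → du m (≤-<-trans m≤j j<i))

  closer-neighbour : ∀ {u v s k} → D u s ≡ just (suc k) → (∀ m → m ≤ suc k → ¬ Walk G m v s) →
    ∃[ w ] (Adj G w s × D u w ≢ D v w)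
  closer-neighbour Dus far with Dist-last-step (D-Dist Dus)
  ... | w , ws , duw = w , ws , λ eq →
    far _ ≤-refl (snoc (proj₁ (D-Dist (trans (sym eq) (D-≡ duw)))) ws)

  Shadows : Fin n → Fin n → Set
  Shadows x s = x ≢ s × ¬ Adj G x s × (∀ w → Adj G w s → Adj G x w)

  shadows? : ∀ x s → Dec (Shadows x s)
  shadows? x s = ¬? (x ≟ᶠ s) ×-dec ¬? (adj? x s) ×-dec all? (λ w → adj? w s →-dec adj? x w)

  shadows-equidistant : ∀ {x y s} → Shadows x s → Shadows y s → D x s ≡ D y s
  shadows-equidistant {s = s} (x≢s , ¬xs , xN) (y≢s , ¬ys , yN) with any? (λ w → adj? w s)
  ... | yes (w , ws) =
    trans (D-≡ (Dist-two x≢s ¬xs (xN w ws) ws)) (sym (D-≡ (Dist-two y≢s ¬ys (yN w ws) ws)))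
  ... | no ∄ = trans (D-≡ (Dist-∞ x≢s isolated)) (sym (D-≡ (Dist-∞ y≢s isolated)))
    where
    isolated : ∀ w → ¬ Adj G w s
    isolated w ws = ∄ (w , ws)

  Agree : Subset n → Fin n → Fin n → Set
  Agree T x y = ∀ t → t ∈ T → D x t ≡ D y t

  Separated : Subset n → Fin n → Fin n → Set
  Separated T x y = ∃[ t ] (t ∈ T × D x t ≢ D y t)

  agree? : ∀ T x y → Dec (Agree T x y)
  agree? T x y = all? (λ t → t ∈? T →-dec D x t ≟∞ D y t)

  agree-or-separated : ∀ T x y → Agree T x y ⊎ Separated T x y
  agree-or-separated T x y with any? (λ t → t ∈? T ×-dec ¬? (D x t ≟∞ D y t))
  ... | yes separating = inj₂ separating
  ... | no ∄ = inj₁ λ t t∈T → decidable-stable (D x t ≟∞ D y t) λ ne → ∄ (t , t∈T , ne)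

  agree-insert : ∀ {T x y s} → Agree (T - s) x y → D x s ≡ D y s → Agree T x y
  agree-insert {s = s} agree eq t t∈T with t ≟ᶠ s
  ... | yes refl = eq
  ... | no t≢s = agree t (x∈p∧x≢y⇒x∈p-y t∈T t≢s)

  separated-sym : ∀ {T x y} → Separated T x y → Separated T y x
  separated-sym (t , t∈T , ne) = t , t∈T , ne ∘ sym

  resolving⇒separated : ∀ {T x y} → Resolving G T → x ≢ y → Separated T x y
  resolving⇒separated res x≢y with res _ _ x≢y
  ... | t , t∈T , _ , _ , dx , dy , ne =
    t , t∈T , λ eq → ne (trans (sym (D-≡ dx)) (trans eq (D-≡ dy)))

  separated⇒resolving : ∀ {T} → (∀ {x y} → x ≢ y → Separated T x y) → Resolving G T
  separated⇒resolving sep x y x≢y with sep x≢y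
  ... | t , t∈T , ne = t , t∈T , D x t , D y t , D-dist x t , D-dist y t , ne

  resolving-agree⇒≡ : ∀ {T x y} → Resolving G T → Agree T x y → x ≡ y
  resolving-agree⇒≡ {x = x} {y} res agree with x ≟ᶠ y
  ... | yes x≡y = x≡y
  ... | no x≢y with resolving⇒separated res x≢y
  ...   | t , t∈T , ne = ⊥-elim (ne (agree t t∈T))

resolving-nonempty : ∀ {n} {G : Graph n} {S} → 1 < n → Resolving G S → Nonempty S
resolving-nonempty (s≤s (s≤s _)) res with res Fin.zero (Fin.suc Fin.zero) (λ ())
... | s , s∈S , _ = s , s∈S

-- Extending a resolving set to a fault-tolerant one

module FaultTolerantExtension {n} (G : Graph n) (D : Fin n → Fin n → ℕ∞)
    (D-dist : ∀ u v → Dist G u v (D u v)) (S : Subset n) (S-resolving : Resolving G S) where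

  open Distances G D D-dist

  signature : Fin n → Fin n → List ℕ∞
  signature s x = map (D x) (elements (S - s))

  neighbourSignatures : Fin n → List (List ℕ∞)
  neighbourSignatures s = choiceSequences (map (around ∘ D s) (elements (S - s)))

  neighbours : Fin n → List (Fin n)
  neighbours s = preimages (List-≡-dec _≟∞_) (λ w → adj? w s) (signature s) (neighbourSignatures s)

  Twin : Fin n → Fin n → Set
  Twin s x = Shadows x s × Agree (S - s) x s

  twin? : ∀ s x → Dec (Twin s x)
  twin? s x = shadows? x s ×-dec agree? (S - s) x s

  -- Twins of s are unique, so the constant map is injective on them.
  twins : Fin n → List (Fin n)
  twins s = preimages _≟⊤_ (twin? s) (const tt) [ tt ]ˡ

  cluster : Fin n → List (Fin n)
  cluster s = s ∷ˡ twins s ++ neighbours s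

  S⁺ : Subset n
  S⁺ = fromList (concatMap cluster (elements S))

  ∈-cluster⇒∈-S⁺ : ∀ {s x} → s ∈ S → x ∈ˡ cluster s → x ∈ S⁺
  ∈-cluster⇒∈-S⁺ s∈S x∈ =
    ∈-fromList⁺ (∈-concatMap⁺ cluster (Any.map (λ { refl → x∈ }) (∈-elements⁺ s∈S)))

  ∈-S⇒∈-S⁺ : ∀ {s} → s ∈ S → s ∈ S⁺
  ∈-S⇒∈-S⁺ s∈S = ∈-cluster⇒∈-S⁺ s∈S (Any.here refl)

  equidistant-signature⇒≡ : ∀ {s x y} → D x s ≡ D y s → signature s x ≡ signature s y → x ≡ y
  equidistant-signature⇒≡ Dxs≡Dys eq = resolving-agree⇒≡ S-resolving
    (agree-insert (λ t t∈ → map-≡⇒∈-≡ eq (∈-elements⁺ t∈)) Dxs≡Dys)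

  adj⇒∈-neighbours : ∀ {w s} → Adj G w s → w ∈ˡ neighbours s
  adj⇒∈-neighbours {w} {s} ws = ∈-preimages _ _ (signature s) injective _ ws
    (map-∈-choiceSequences (around ∘ D s) (λ t → Dist-neighbour ws (D-dist s t) (D-dist w t))
      (elements (S - s)))
    where
    injective : ∀ {x y} → Adj G x s → Adj G y s → signature s x ≡ signature s y → x ≡ y
    injective xs ys = equidistant-signature⇒≡ (trans (adj⇒D≡1 xs) (sym (adj⇒D≡1 ys)))

  twin⇒∈-twins : ∀ {s x} → Twin s x → x ∈ˡ twins s
  twin⇒∈-twins {s} tx = ∈-preimages _ _ (const tt) unique [ tt ]ˡ tx (Any.here refl)
    where
    unique : ∀ {x y} → Twin s x → Twin s y → const tt x ≡ const tt y → x ≡ y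
    unique (sx , ax) (sy , ay) _ = resolving-agree⇒≡ S-resolving
      (agree-insert (λ t t∈ → trans (ax t t∈) (sym (ay t t∈))) (shadows-equidistant sx sy))

  neighbour⇒∈-S⁺ : ∀ {w s} → s ∈ S → Adj G w s → w ∈ S⁺
  neighbour⇒∈-S⁺ s∈S ws = ∈-cluster⇒∈-S⁺ s∈S (Any.there (∈-++⁺ʳ (twins _) (adj⇒∈-neighbours ws)))

  twin⇒∈-S⁺ : ∀ {s x} → s ∈ S → Twin s x → x ∈ S⁺
  twin⇒∈-S⁺ s∈S tx = ∈-cluster⇒∈-S⁺ s∈S (Any.there (∈-++⁺ˡ (twin⇒∈-twins tx)))

  length-cluster-≤ : ∀ {s} → s ∈ S → length (cluster s) ≤ 2 + 3 ^ (∣ S ∣ ∸ 1)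
  length-cluster-≤ {s} s∈S = s≤s (begin
    length (twins s ++ neighbours s)           ≡⟨ length-++ (twins s) ⟩
    length (twins s) + length (neighbours s)
      ≤⟨ +-mono-≤ (length-preimages-≤ _≟⊤_ (twin? s) (const tt) [ tt ]ˡ) neighbours-≤ ⟩
    1 + 3 ^ (∣ S ∣ ∸ 1)                        ∎)
    where
    open Data.Nat.Properties.≤-Reasoning
    neighbours-≤ : length (neighbours s) ≤ 3 ^ (∣ S ∣ ∸ 1)
    neighbours-≤ = begin
      length (neighbours s)
        ≤⟨ length-preimages-≤ (List-≡-dec _≟∞_) (λ w → adj? w s) (signature s) (neighbourSignatures s) ⟩
      length (neighbourSignatures s)
        ≤⟨ length-choiceSequences-≤ (around ∘ D s) (length-around-≤ ∘ D s) (elements (S - s)) ⟩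
      3 ^ length (elements (S - s))  ≡⟨ cong (3 ^_) (length-elements (S - s)) ⟩
      3 ^ ∣ S - s ∣                   ≤⟨ ^-monoʳ-≤ 3 (∣p-x∣≤∣p∣∸1 s∈S) ⟩
      3 ^ (∣ S ∣ ∸ 1)                ∎

  ∣S⁺∣≤ : ∣ S⁺ ∣ ≤ ∣ S ∣ * (2 + 3 ^ (∣ S ∣ ∸ 1))
  ∣S⁺∣≤ = begin
    ∣ S⁺ ∣                                   ≤⟨ ∣fromList∣≤length (concatMap cluster (elements S)) ⟩
    length (concatMap cluster (elements S))  ≤⟨ length-concatMap-≤ cluster bound (elements S) cluster-≤ ⟩
    length (elements S) * bound              ≡⟨ cong (_* bound) (length-elements S) ⟩
    ∣ S ∣ * bound                            ∎
    where
    open Data.Nat.Properties.≤-Reasoning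
    bound : ℕ
    bound = 2 + 3 ^ (∣ S ∣ ∸ 1)
    cluster-≤ : ∀ {s} → s ∈ˡ elements S → length (cluster s) ≤ bound
    cluster-≤ = length-cluster-≤ ∘ ∈-elements⁻

  separate-from-centre : ∀ {s v} → s ∈ S → v ≢ s → Separated (S⁺ - s) s v
  separate-from-centre {s} {v} s∈S v≢s with v ∈? S⁺
  ... | yes v∈S⁺ = v , x∈p∧x≢y⇒x∈p-y v∈S⁺ v≢s , λ eq → v≢s (sym (D≡0⇒≡ (trans eq (D-≡ Dist-refl))))
  ... | no v∉S⁺ with agree-or-separated (S - s) s v
  ...   | inj₂ (t , t∈ , ne) =
    t , x∈p∧x≢y⇒x∈p-y (∈-S⇒∈-S⁺ (p─q⊆p S ⁅ s ⁆ t∈)) (x∈p-y⇒x≢y t∈) , ne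
  ...   | inj₁ agree with any? (λ w → adj? w s ×-dec ¬? (adj? v w))
  ...     | yes (w , ws , ¬vw) = w , x∈p∧x≢y⇒x∈p-y (neighbour⇒∈-S⁺ s∈S ws) (adj⇒≢ ws) ,
    λ eq → ¬vw (D≡1⇒adj (trans (sym eq) (adj⇒D≡1 (Graph.sym G ws))))
  ...     | no ∄ = ⊥-elim (v∉S⁺ (twin⇒∈-S⁺ s∈S twin))
    where
    twin : Twin s v
    twin = (v≢s , v∉S⁺ ∘ neighbour⇒∈-S⁺ s∈S ,
            λ w ws → decidable-stable (adj? v w) λ ¬vw → ∄ (w , ws , ¬vw))
         , λ t t∈ → sym (agree t t∈)

  separate-closer : ∀ {s u v} → s ∈ S → Closer u v s → Separated (S⁺ - s) u v
  separate-closer s∈S (zero , Dus≡0 , far) with D≡0⇒≡ Dus≡0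
  ... | refl = separate-from-centre s∈S λ { refl → far 0 z≤n here }
  separate-closer s∈S (suc k , Dus , far) with closer-neighbour Dus far
  ... | w , ws , ne = w , x∈p∧x≢y⇒x∈p-y (neighbour⇒∈-S⁺ s∈S ws) (adj⇒≢ ws) , ne

  S⁺-resolving-without : ∀ t → Resolving G (S⁺ - t)
  S⁺-resolving-without t = separated⇒resolving λ u≢v → separate (resolving⇒separated S-resolving u≢v)
    where
    separate : ∀ {u v} → Separated S u v → Separated (S⁺ - t) u v
    separate (s , s∈S , ne) with s ≟ᶠ t
    ... | no s≢t = s , x∈p∧x≢y⇒x∈p-y (∈-S⇒∈-S⁺ s∈S) s≢t , ne
    ... | yes refl with closer-or-closer ne
    ...   | inj₁ closer = separate-closer s∈S closer
    ...   | inj₂ closer = separated-sym (separate-closer s∈S closer)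

  S⁺-fault-tolerant : Nonempty S → FaultTolerantResolving G S⁺
  S⁺-fault-tolerant (s , s∈S) = (s , ∈-S⇒∈-S⁺ s∈S) , λ t _ → S⁺-resolving-without t

theorem5 : ∀ (n : ℕ) → 1 < n → (G : Graph n) → (d f : ℕ) →
    IsMetricDim G d → IsFTMetricDim G f →
    f ≤ d * (2 + 3 ^ (d ∸ 1))
theorem5 n 1<n G d f ((S , S-resolving , ∣S∣≡d) , _) (_ , ftdim-minimal) =
  decidable-stable (f ≤? d * (2 + 3 ^ (d ∸ 1))) (¬¬-map ftdim-bounded (¬¬-distance-function G))
  where
  ftdim-bounded : DistanceFunction G → f ≤ d * (2 + 3 ^ (d ∸ 1))
  ftdim-bounded (D , D-dist) = begin
    f                              ≤⟨ ftdim-minimal S⁺ S⁺-ftr ⟩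
    ∣ S⁺ ∣                         ≤⟨ ∣S⁺∣≤ ⟩
    ∣ S ∣ * (2 + 3 ^ (∣ S ∣ ∸ 1))  ≡⟨ cong (λ k → k * (2 + 3 ^ (k ∸ 1))) ∣S∣≡d ⟩
    d * (2 + 3 ^ (d ∸ 1))          ∎
    where
    open Data.Nat.Properties.≤-Reasoning
    open FaultTolerantExtension G D D-dist S S-resolving
    S⁺-ftr : FaultTolerantResolving G S⁺
    S⁺-ftr = S⁺-fault-tolerant (resolving-nonempty 1<n S-resolving)
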